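{- Let $G$ be a finite simple graph and let $S$ be an odd dominating set of $G$. Then $|S| \equiv \rho(G) \pmod 2$. Equivalently, $|V(G)\setminus S| \equiv \nu(G) \pmod 2$.
   Context: For a vertex $u$ of a finite simple graph $G$, the closed neighborhood is $N[u]=\{v\in V(G) : v \text{ is adjacent to } u \text{ or } v=u\}$. A set $S\subseteq V(G)$ is an odd dominating set if $|N[u]\cap S|$ is odd for every $u\in V(G)$. With $V(G)=\{v_1,\dots,v_n\}$, the closed neighborhood matrix $N(G)$ is the $n\times n$ matrix over the field $\mathbb{Z}_2$ whose $i$-th column is the characteristic vector of $N[v_i]$ (i.e. the adjacency matrix plus the identity, over $\mathbb{Z}_2$). The rank $\rho(G)$ is the dimension of the column space of $N(G)$ over $\mathbb{Z}_2$, and the nullity $\nu(G)$ is the dimension of its kernel over $\mathbb{Z}_2$; thus $\rho(G)+\nu(G)=n$. -}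

module Defs where

open import Data.Nat using (ℕ; suc; _%_; _+_)
open import Data.Fin using (Fin; _≟_)
open import Data.Bool using (Bool; true; false; _xor_; _∧_; if_then_else_; not)
open import Data.Product using (Σ; ∃; _×_)
open import Relation.Binary.PropositionalEquality using (_≡_; _≢_)
open import Relation.Nullary using (¬_; yes; no)

-- Z₂ is modelled by Bool: addition = xor, multiplication = ∧, zero = false.

⨁ : ∀ {n} → (Fin n → Bool) → Bool
⨁ {ℕ.zero} f = false
⨁ {suc n} f = f Fin.zero xor ⨁ (λ i → f (Fin.suc i))

Vec₂ : ℕ → Set
Vec₂ n = Fin n → Bool

record Graph (n : ℕ) : Set where
  field
    adj   : Fin n → Fin n → Bool
    sym   : ∀ i j → adj i j ≡ adj j i
    irref : ∀ i → adj i i ≡ false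

-- number of elements of a subset S ⊆ Fin n (given by its characteristic vector)
card : ∀ {n} → Vec₂ n → ℕ
card {ℕ.zero} S = 0
card {suc n} S = (if S Fin.zero then 1 else 0) + card (λ i → S (Fin.suc i))

inN : ∀ {n} → Graph n → Fin n → Fin n → Bool
inN G u v with v ≟ u
... | yes _ = true
... | no _ = Graph.adj G u v

OddDominating : ∀ {n} → Graph n → Vec₂ n → Set
OddDominating G S = ∀ u → card (λ v → inN G u v ∧ S v) % 2 ≡ 1

-- closed neighbourhood matrix N(G): entry (i , j) = [v_i ∈ N[v_j]]
-- (column j is the characteristic vector of N[v_j]).
NMat : ∀ {n} → Graph n → Fin n → Fin n → Bool
NMat G i j = inN G j i

mulV : ∀ {m n} → (Fin m → Fin n → Bool) → Vec₂ n → Vec₂ m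
mulV M x i = ⨁ (λ j → M i j ∧ x j)

lincomb : ∀ {r n} → (Fin r → Vec₂ n) → Vec₂ r → Vec₂ n
lincomb v c i = ⨁ (λ k → c k ∧ v k i)

LinIndep : ∀ {r n} → (Fin r → Vec₂ n) → Set
LinIndep v = ∀ c → (∀ i → lincomb v c i ≡ false) → ∀ k → c k ≡ false

IsDim : ∀ {n} → (Vec₂ n → Set) → ℕ → Set
IsDim {n} W d =
  (Σ (Fin d → Vec₂ n) λ v → (∀ k → W (v k)) × LinIndep v)
  × (∀ (v : Fin (suc d) → Vec₂ n) → (∀ k → W (v k)) → ¬ LinIndep v)

ColSpace : ∀ {m n} → (Fin m → Fin n → Bool) → Vec₂ m → Set
ColSpace M y = ∃ λ x → ∀ i → mulV M x i ≡ y i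

Kernel : ∀ {m n} → (Fin m → Fin n → Bool) → Vec₂ n → Set
Kernel M x = ∀ i → mulV M x i ≡ false

IsRank : ∀ {n} → Graph n → ℕ → Set
IsRank G r = IsDim (ColSpace (NMat G)) r

IsNullity : ∀ {n} → Graph n → ℕ → Set
IsNullity G k = IsDim (Kernel (NMat G)) k

compl : ∀ {n} → Vec₂ n → Vec₂ n
compl S i = not (S i)

-- An odd dominating set is a solution of N S = 1, and 1 is the diagonal of the symmetric matrix N.
-- For every symmetric M over Z₂ and every s with M s = diag M we show rank M ≡ s · diag M (mod 2),
-- by symmetric Gaussian elimination.  Pivoting on a diagonal entry Mᵢᵢ = 1 lowers the rank by one;
-- the Schur complement M′ with s′ = s minus its i-th entry again satisfies M′ s′ = diag M′, and
-- s · diag M = s′ · diag M′ + 1.  If the diagonal vanishes, pivoting on Mᵢⱼ = Mⱼᵢ = 1 lowers the rank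
-- by two and leaves a symmetric matrix with zero diagonal, so such matrices have even rank.  For N
-- this gives |S| ≡ ρ(G), and ν(G) = n - ρ(G) together with |V ∖ S| = n - |S| gives the second claim.
{-# OPTIONS --safe #-}
module Submission where

open import Defs
open import Data.Nat using (ℕ; zero; suc; _+_; _%_; _≤_; _≤′_; ≤′-refl; ≤′-step)
open import Data.Nat.Properties using (≤-antisym; ≰⇒>; _≤?_; ≤⇒≤′; +-comm; +-suc)
open import Data.Nat.DivMod using ([m+n]%n≡m%n)
open import Data.Fin using (Fin; _≟_; punchIn; punchOut) renaming (zero to fz; suc to fs)
open import Data.Fin.Properties using (any?; punchInᵢ≢i; punchIn-punchOut)
open import Data.Bool using (Bool; true; false; _xor_; _∧_; not; if_then_else_)
open import Data.Bool.Properties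
  using (∧-comm; ∧-zeroʳ; ∧-identityʳ; ∧-idem; ∧-distribˡ-xor; xor-identityʳ; xor-same; xor-comm;
         not-involutive; not-distribˡ-xor; ¬-not)
  renaming (_≟_ to _≟ᵇ_)
open import Data.Bool.Solver using (module xor-∧-Solver)
open import Data.Empty using (⊥-elim)
open import Data.Product using (Σ; ∃; _×_; _,_; proj₁; proj₂)
open import Data.Sum using (_⊎_; inj₁; inj₂)
open import Data.Vec.Functional using (insertAt; _∷_)
open import Data.Vec.Functional.Properties using (insertAt-lookup; insertAt-punchIn)
open import Function using (_∘_)
open import Relation.Binary.PropositionalEquality
  using (_≡_; _≢_; refl; sym; trans; cong; cong₂; module ≡-Reasoning)
open import Relation.Nullary using (¬_; yes; no; does)
open import Relation.Nullary.Decidable using (dec-true; dec-false)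

open xor-∧-Solver using (solve; _:=_; _:+_; _:*_; con)
open ≡-Reasoning

Mat₂ : ℕ → ℕ → Set
Mat₂ m n = Fin m → Fin n → Bool

xor-moveˡ : ∀ x {y z} → x xor y ≡ z → y ≡ x xor z
xor-moveˡ x {y} refl = solve 2 (λ x y → y := x :+ (x :+ y)) refl x y

trueEntry? : ∀ {n} (f : Vec₂ n) → (∃ λ i → f i ≡ true) ⊎ (∀ i → f i ≡ false)
trueEntry? f with any? (λ i → f i ≟ᵇ true)
... | yes found = inj₁ found
... | no none   = inj₂ λ i → ¬-not (λ fi≡true → none (i , fi≡true))

nonzeroEntry? : ∀ {m n} (M : Mat₂ m n) →
  (∃ λ i → ∃ λ j → M i j ≡ true) ⊎ (∀ i j → M i j ≡ false)
nonzeroEntry? M with any? (λ i → any? (λ j → M i j ≟ᵇ true))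
... | yes found = inj₁ found
... | no none   = inj₂ λ i j → ¬-not (λ Mij≡true → none (i , j , Mij≡true))

punchIn-cases : ∀ {n} (a i : Fin (suc n)) → i ≡ a ⊎ ∃ λ k → i ≡ punchIn a k
punchIn-cases a i with i ≟ a
... | yes i≡a = inj₁ i≡a
... | no  i≢a = inj₂ (punchOut (i≢a ∘ sym) , sym (punchIn-punchOut (i≢a ∘ sym)))

≗-byPunchIn : ∀ {n} {A : Set} {f g : Fin (suc n) → A} (a : Fin (suc n)) →
  f a ≡ g a → (∀ k → f (punchIn a k) ≡ g (punchIn a k)) → ∀ i → f i ≡ g i
≗-byPunchIn a at-a elsewhere i with punchIn-cases a i
... | inj₁ refl       = at-a
... | inj₂ (k , refl) = elsewhere k

-- Sums and parities

⨁-cong : ∀ {n} {f g : Vec₂ n} → (∀ i → f i ≡ g i) → ⨁ f ≡ ⨁ g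
⨁-cong {zero}  f≗g = refl
⨁-cong {suc n} f≗g = cong₂ _xor_ (f≗g fz) (⨁-cong (f≗g ∘ fs))

⨁-zero : ∀ {n} {f : Vec₂ n} → (∀ i → f i ≡ false) → ⨁ f ≡ false
⨁-zero {zero}  f≗0 = refl
⨁-zero {suc n} f≗0 = cong₂ _xor_ (f≗0 fz) (⨁-zero (f≗0 ∘ fs))

⨁-xor : ∀ {n} (f g : Vec₂ n) → ⨁ (λ i → f i xor g i) ≡ ⨁ f xor ⨁ g
⨁-xor {zero}  f g = refl
⨁-xor {suc n} f g = begin
  (f fz xor g fz) xor ⨁ (λ i → f (fs i) xor g (fs i))  ≡⟨ cong ((f fz xor g fz) xor_) (⨁-xor (f ∘ fs) (g ∘ fs)) ⟩
  (f fz xor g fz) xor (⨁ (f ∘ fs) xor ⨁ (g ∘ fs))       ≡⟨ interchange (f fz) (g fz) (⨁ (f ∘ fs)) (⨁ (g ∘ fs)) ⟩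
  (f fz xor ⨁ (f ∘ fs)) xor (g fz xor ⨁ (g ∘ fs))       ∎
  where
  interchange : ∀ a b c d → (a xor b) xor (c xor d) ≡ (a xor c) xor (b xor d)
  interchange = solve 4 (λ a b c d → (a :+ b) :+ (c :+ d) := (a :+ c) :+ (b :+ d)) refl

⨁-∧ˡ : ∀ {n} b (f : Vec₂ n) → ⨁ (λ i → b ∧ f i) ≡ b ∧ ⨁ f
⨁-∧ˡ {zero}  b f = sym (∧-zeroʳ b)
⨁-∧ˡ {suc n} b f =
  trans (cong ((b ∧ f fz) xor_) (⨁-∧ˡ b (f ∘ fs))) (sym (∧-distribˡ-xor b (f fz) (⨁ (f ∘ fs))))

⨁-∧ʳ : ∀ {n} b (f : Vec₂ n) → ⨁ (λ i → f i ∧ b) ≡ ⨁ f ∧ b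
⨁-∧ʳ b f = trans (⨁-cong (λ i → ∧-comm (f i) b)) (trans (⨁-∧ˡ b f) (∧-comm b (⨁ f)))

⨁-swap : ∀ {m n} (f : Mat₂ m n) → ⨁ (λ i → ⨁ (f i)) ≡ ⨁ (λ j → ⨁ (λ i → f i j))
⨁-swap {zero} {n} f = sym (⨁-zero {n} (λ _ → refl))
⨁-swap {suc m} f =
  trans (cong (⨁ (f fz) xor_) (⨁-swap (f ∘ fs))) (sym (⨁-xor (f fz) (λ j → ⨁ (λ i → f (fs i) j))))

⨁-punchIn : ∀ {n} (f : Vec₂ (suc n)) a → ⨁ f ≡ f a xor ⨁ (f ∘ punchIn a)
⨁-punchIn f fz = refl
⨁-punchIn {suc n} f (fs a) =
  trans (cong (f fz xor_) (⨁-punchIn (f ∘ fs) a)) (swap (f fz) (f (fs a)) (⨁ (f ∘ fs ∘ punchIn a)))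
  where
  swap : ∀ x y z → x xor (y xor z) ≡ y xor (x xor z)
  swap = solve 3 (λ x y z → x :+ (y :+ z) := y :+ (x :+ z)) refl

⨁-xor-∧ : ∀ {n} β (f g z : Vec₂ n) →
  ⨁ (λ l → (f l xor (β ∧ g l)) ∧ z l) ≡ ⨁ (λ l → f l ∧ z l) xor (β ∧ ⨁ (λ l → g l ∧ z l))
⨁-xor-∧ β f g z = begin
  ⨁ (λ l → (f l xor (β ∧ g l)) ∧ z l)                     ≡⟨ ⨁-cong (λ l → distrib (f l) (g l) (z l)) ⟩
  ⨁ (λ l → (f l ∧ z l) xor (β ∧ (g l ∧ z l)))             ≡⟨ ⨁-xor (λ l → f l ∧ z l) (λ l → β ∧ (g l ∧ z l)) ⟩
  ⨁ (λ l → f l ∧ z l) xor ⨁ (λ l → β ∧ (g l ∧ z l))       ≡⟨ cong (⨁ (λ l → f l ∧ z l) xor_) (⨁-∧ˡ β (λ l → g l ∧ z l)) ⟩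
  ⨁ (λ l → f l ∧ z l) xor (β ∧ ⨁ (λ l → g l ∧ z l))       ∎
  where
  distrib : ∀ f g z → (f xor (β ∧ g)) ∧ z ≡ (f ∧ z) xor (β ∧ (g ∧ z))
  distrib f g z = solve 4 (λ β f g z → (f :+ (β :* g)) :* z := (f :* z) :+ (β :* (g :* z))) refl β f g z

δ : ∀ {n} → Fin n → Fin n → Bool
δ i j = does (i ≟ j)

⨁-δ : ∀ {n} (f : Vec₂ n) a → ⨁ (λ j → f j ∧ δ j a) ≡ f a
⨁-δ {suc n} f a = begin
  ⨁ (λ j → f j ∧ δ j a)                                              ≡⟨ ⨁-punchIn (λ j → f j ∧ δ j a) a ⟩
  (f a ∧ δ a a) xor ⨁ (λ k → f (punchIn a k) ∧ δ (punchIn a k) a)    ≡⟨ cong₂ _xor_ on-a off-a ⟩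
  f a xor false                                                      ≡⟨ xor-identityʳ (f a) ⟩
  f a                                                                ∎
  where
  on-a : f a ∧ δ a a ≡ f a
  on-a = trans (cong (f a ∧_) (dec-true (a ≟ a) refl)) (∧-identityʳ (f a))
  off-a : ⨁ (λ k → f (punchIn a k) ∧ δ (punchIn a k) a) ≡ false
  off-a = ⨁-zero λ k → trans (cong (f (punchIn a k) ∧_) (dec-false (punchIn a k ≟ a) (punchInᵢ≢i a k)))
                             (∧-zeroʳ (f (punchIn a k)))

odd : ℕ → Bool
odd zero    = false
odd (suc n) = not (odd n)

odd-+ : ∀ m n → odd (m + n) ≡ odd m xor odd n
odd-+ zero    n = refl
odd-+ (suc m) n = trans (cong not (odd-+ m n)) (not-distribˡ-xor (odd m) (odd n))

⨁≡odd-card : ∀ {n} (f : Vec₂ n) → ⨁ f ≡ odd (card f)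
⨁≡odd-card {zero}  f = refl
⨁≡odd-card {suc n} f with f fz
... | true  = cong not (⨁≡odd-card (f ∘ fs))
... | false = ⨁≡odd-card (f ∘ fs)

card-compl : ∀ {n} (S : Vec₂ n) → card (compl S) + card S ≡ n
card-compl {zero}  S = refl
card-compl {suc n} S with S fz
... | true  = trans (+-suc (card (compl (S ∘ fs))) (card (S ∘ fs))) (cong suc (card-compl (S ∘ fs)))
... | false = cong suc (card-compl (S ∘ fs))

%2≡odd : ∀ n → n % 2 ≡ (if odd n then 1 else 0)
%2≡odd zero          = refl
%2≡odd (suc zero)    = refl
%2≡odd (suc (suc n)) = begin
  suc (suc n) % 2                      ≡⟨ cong (_% 2) (+-comm 2 n) ⟩
  (n + 2) % 2                          ≡⟨ [m+n]%n≡m%n n 2 ⟩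
  n % 2                                ≡⟨ %2≡odd n ⟩
  (if odd n then 1 else 0)             ≡⟨ cong (if_then 1 else 0) (sym (not-involutive (odd n))) ⟩
  (if odd (suc (suc n)) then 1 else 0) ∎

odd≡⇒%2≡ : ∀ m n → odd m ≡ odd n → m % 2 ≡ n % 2
odd≡⇒%2≡ m n odd≡ = trans (%2≡odd m) (trans (cong (if_then 1 else 0) odd≡) (sym (%2≡odd n)))

%2≡1⇒odd : ∀ n → n % 2 ≡ 1 → odd n ≡ true
%2≡1⇒odd n n%2≡1 with odd n | %2≡odd n
... | true  | _ = refl
... | false | n%2≡0 with trans (sym n%2≡1) n%2≡0
...   | ()

odd-compl : ∀ {n} (S : Vec₂ n) ρ κ → ρ + κ ≡ n → odd ρ ≡ odd (card S) → odd κ ≡ odd (card (compl S))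
odd-compl S ρ κ ρ+κ≡n odd-ρ = begin
  odd κ                                                     ≡⟨ sym (cancelˡ (odd ρ) (odd κ)) ⟩
  (odd ρ xor odd κ) xor odd ρ                               ≡⟨ cong₂ _xor_ (sym (odd-+ ρ κ)) odd-ρ ⟩
  odd (ρ + κ) xor odd (card S)                              ≡⟨ cong (λ t → odd t xor odd (card S))
                                                                    (trans ρ+κ≡n (sym (card-compl S))) ⟩
  odd (card (compl S) + card S) xor odd (card S)            ≡⟨ cong (_xor odd (card S)) (odd-+ (card (compl S)) (card S)) ⟩
  (odd (card (compl S)) xor odd (card S)) xor odd (card S)  ≡⟨ cancelʳ (odd (card (compl S))) (odd (card S)) ⟩
  odd (card (compl S))                                      ∎
  where
  cancelˡ : ∀ x y → (x xor y) xor x ≡ y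
  cancelˡ = solve 2 (λ x y → (x :+ y) :+ x := y) refl
  cancelʳ : ∀ x y → (x xor y) xor y ≡ x
  cancelʳ = solve 2 (λ x y → (x :+ y) :+ y := x) refl

-- Linear independence and dimension

Spans : ∀ {m n} → (Fin m → Vec₂ n) → Vec₂ n → Set
Spans v y = ∃ λ c → ∀ i → lincomb v c i ≡ y i

record Basis {n} (W : Vec₂ n → Set) (d : ℕ) : Set where
  field
    vec         : Fin d → Vec₂ n
    vec∈        : ∀ k → W (vec k)
    independent : LinIndep vec
    spanning    : ∀ y → W y → Spans vec y

LinIndep-tail : ∀ {m n} {v : Fin (suc m) → Vec₂ n} → LinIndep v → LinIndep (v ∘ fs)
LinIndep-tail ind c c-dep k = ind (false ∷ c) c-dep (fs k)

LinIndep-shrink : ∀ {n p q} → p ≤′ q → {v : Fin q → Vec₂ n} → LinIndep v →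
  Σ (Fin p → Fin q) λ f → LinIndep (v ∘ f)
LinIndep-shrink ≤′-refl      ind = (λ k → k) , ind
LinIndep-shrink (≤′-step p≤′q) {v} ind with LinIndep-shrink p≤′q (LinIndep-tail {v = v} ind)
... | f , ind-f = fs ∘ f , ind-f

-- A dependency e of the new family gives the dependency of v with coefficient ⨁ₖ eₖ gₖ at k₀.
LinIndep-eliminate : ∀ {q n} {v : Fin (suc q) → Vec₂ n} k₀ (g : Fin q → Bool) → LinIndep v →
  LinIndep (λ k i → v (punchIn k₀ k) i xor (g k ∧ v k₀ i))
LinIndep-eliminate {q} {v = v} k₀ g ind e e-dep k =
  trans (sym (insertAt-punchIn e k₀ t k)) (ind E E-dep (punchIn k₀ k))
  where
  t : Bool
  t = ⨁ (λ k → e k ∧ g k)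
  E : Vec₂ (suc q)
  E = insertAt e k₀ t
  E-dep : ∀ i → lincomb v E i ≡ false
  E-dep i = begin
    lincomb v E i                                                  ≡⟨ ⨁-punchIn (λ j → E j ∧ v j i) k₀ ⟩
    (E k₀ ∧ v k₀ i) xor ⨁ (λ k → E (punchIn k₀ k) ∧ v (punchIn k₀ k) i)
      ≡⟨ cong₂ (λ x y → (x ∧ v k₀ i) xor y) (insertAt-lookup e k₀ t)
               (⨁-cong (λ k → cong (_∧ v (punchIn k₀ k) i) (insertAt-punchIn e k₀ t k))) ⟩
    (t ∧ v k₀ i) xor ⨁ (λ k → e k ∧ v (punchIn k₀ k) i)
      ≡⟨ cong₂ _xor_ (sym (⨁-∧ʳ (v k₀ i) (λ k → e k ∧ g k))) refl ⟩
    ⨁ (λ k → (e k ∧ g k) ∧ v k₀ i) xor ⨁ (λ k → e k ∧ v (punchIn k₀ k) i)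
      ≡⟨ sym (⨁-xor (λ k → (e k ∧ g k) ∧ v k₀ i) (λ k → e k ∧ v (punchIn k₀ k) i)) ⟩
    ⨁ (λ k → ((e k ∧ g k) ∧ v k₀ i) xor (e k ∧ v (punchIn k₀ k) i))
      ≡⟨ ⨁-cong (λ k → regroup (e k) (g k) (v k₀ i) (v (punchIn k₀ k) i)) ⟩
    ⨁ (λ k → e k ∧ (v (punchIn k₀ k) i xor (g k ∧ v k₀ i)))         ≡⟨ e-dep i ⟩
    false                                                          ∎
    where
    regroup : ∀ e g x y → ((e ∧ g) ∧ x) xor (e ∧ y) ≡ e ∧ (y xor (g ∧ x))
    regroup = solve 4 (λ e g x y → ((e :* g) :* x) :+ (e :* y) := e :* (y :+ (g :* x))) refl

Spans-tail : ∀ {m n} {w : Fin (suc m) → Vec₂ n} {y} c → c fz ≡ false →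
  (∀ i → lincomb w c i ≡ y i) → Spans (w ∘ fs) y
Spans-tail {w = w} c c₀≡0 c-spans =
  c ∘ fs , λ i → trans (cong (λ t → (t ∧ w fz i) xor lincomb (w ∘ fs) (c ∘ fs) i) (sym c₀≡0)) (c-spans i)

exchange : ∀ {n} m (w : Fin m → Vec₂ n) (v : Fin (suc m) → Vec₂ n) →
  (∀ k → Spans w (v k)) → ¬ LinIndep v
exchange zero w v v∈span ind with ind (λ _ → true) v₀≡0 fz
  where
  v₀≡0 : ∀ i → lincomb v (λ _ → true) i ≡ false
  v₀≡0 i = trans (xor-identityʳ (v fz i)) (sym (proj₂ (v∈span fz) i))
... | ()
exchange (suc m) w v v∈span ind with trueEntry? (λ k → proj₁ (v∈span k) fz)
... | inj₂ w₀-unused = exchange m (w ∘ fs) (v ∘ fs) tail∈span (LinIndep-tail {v = v} ind)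
  where
  tail∈span : ∀ k → Spans (w ∘ fs) (v (fs k))
  tail∈span k = Spans-tail {w = w} (proj₁ (v∈span (fs k))) (w₀-unused (fs k)) (proj₂ (v∈span (fs k)))
-- Otherwise v k₀ involves w₀, and adding multiples of v k₀ to the other vectors removes w₀ from them.
... | inj₁ (k₀ , w₀-used) = exchange m (w ∘ fs) v′ v′∈span (LinIndep-eliminate {v = v} k₀ g ind)
  where
  coeff : Fin (suc (suc m)) → Vec₂ (suc m)
  coeff k = proj₁ (v∈span k)
  g : Fin (suc m) → Bool
  g k = coeff (punchIn k₀ k) fz
  v′ : Fin (suc m) → Vec₂ _
  v′ k i = v (punchIn k₀ k) i xor (g k ∧ v k₀ i)
  v′∈span : ∀ k → Spans (w ∘ fs) (v′ k)
  v′∈span k = Spans-tail {w = w} c′ c′₀≡0 λ i → begin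
    lincomb w c′ i                                                 ≡⟨ ⨁-xor-∧ (g k) (coeff (punchIn k₀ k)) (coeff k₀) (λ l → w l i) ⟩
    lincomb w (coeff (punchIn k₀ k)) i xor (g k ∧ lincomb w (coeff k₀) i)
      ≡⟨ cong₂ (λ x y → x xor (g k ∧ y)) (proj₂ (v∈span (punchIn k₀ k)) i) (proj₂ (v∈span k₀) i) ⟩
    v′ k i                                                         ∎
    where
    c′ : Vec₂ (suc m)
    c′ l = coeff (punchIn k₀ k) l xor (g k ∧ coeff k₀ l)
    c′₀≡0 : c′ fz ≡ false
    c′₀≡0 = begin
      g k xor (g k ∧ coeff k₀ fz)   ≡⟨ cong (λ t → g k xor (g k ∧ t)) w₀-used ⟩
      g k xor (g k ∧ true)          ≡⟨ cong (g k xor_) (∧-identityʳ (g k)) ⟩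
      g k xor g k                   ≡⟨ xor-same (g k) ⟩
      false                         ∎

independent-≤ : ∀ {n d p} {W : Vec₂ n → Set} →
  (∀ (v : Fin (suc d) → Vec₂ n) → (∀ k → W (v k)) → ¬ LinIndep v) →
  (u : Fin p → Vec₂ n) → (∀ k → W (u k)) → LinIndep u → p ≤ d
independent-≤ {d = d} {p} no-larger u u∈W ind with p ≤? d
... | yes p≤d = p≤d
... | no  p≰d with LinIndep-shrink (≤⇒≤′ (≰⇒> p≰d)) ind
...   | f , ind-f = ⊥-elim (no-larger (u ∘ f) (u∈W ∘ f) ind-f)

dim-unique : ∀ {n} {W : Vec₂ n → Set} {ρ d} → Basis W ρ → IsDim W d → d ≡ ρ
dim-unique {W = W} {ρ = ρ} B ((u , u∈W , u-indep) , no-larger) =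
  ≤-antisym (independent-≤ {W = W} (λ v v∈W → exchange ρ vec v (λ k → spanning (v k) (v∈W k))) u u∈W u-indep)
            (independent-≤ {W = W} no-larger vec vec∈ independent)
  where open Basis B

-- Gaussian elimination

mulV-congʳ : ∀ {m n} (M : Mat₂ m n) {x y : Vec₂ n} → (∀ j → x j ≡ y j) → ∀ i → mulV M x i ≡ mulV M y i
mulV-congʳ M x≗y i = ⨁-cong (λ j → cong (M i j ∧_) (x≗y j))

record RankNullity {m n} (M : Mat₂ m n) : Set where
  field
    rank nullity : ℕ
    rank+nullity : rank + nullity ≡ n
    columnBasis  : Basis (ColSpace M) rank
    kernelBasis  : Basis (Kernel M) nullity

zero-rankNullity : ∀ {m n} (M : Mat₂ m n) → (∀ i j → M i j ≡ false) → RankNullity M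
zero-rankNullity {n = n} M M≡0 = record
  { rank         = 0
  ; nullity      = n
  ; rank+nullity = refl
  ; columnBasis  = record
    { vec         = λ ()
    ; vec∈        = λ ()
    ; independent = λ _ _ ()
    ; spanning    = λ y (x , Mx≗y) → (λ ()) , λ i → trans (sym (Mx≡0 x i)) (Mx≗y i)
    }
  ; kernelBasis  = record
    { vec         = δ
    ; vec∈        = λ k → Mx≡0 (δ k)
    ; independent = λ c c-dep i → trans (sym (⨁-δ c i)) (c-dep i)
    ; spanning    = λ y _ → y , ⨁-δ y
    }
  }
  where
  Mx≡0 : ∀ x i → mulV M x i ≡ false
  Mx≡0 x i = ⨁-zero (λ j → cong (_∧ x j) (M≡0 i j))

module Pivot {r c} (M : Mat₂ (suc r) (suc c)) (a : Fin (suc r)) (b : Fin (suc c))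
             (pivot : M a b ≡ true) where

  schur : Mat₂ r c
  schur k l = M (punchIn a k) (punchIn b l) xor (M (punchIn a k) b ∧ M a (punchIn b l))

  pivotRow : Vec₂ c → Bool
  pivotRow z = ⨁ (λ l → M a (punchIn b l) ∧ z l)

  pivotRow-cong : ∀ {z z′} → (∀ l → z l ≡ z′ l) → pivotRow z ≡ pivotRow z′
  pivotRow-cong z≗z′ = ⨁-cong (λ l → cong (M a (punchIn b l) ∧_) (z≗z′ l))

  pivotRow-lincomb : ∀ {κ} (w : Fin κ → Vec₂ c) e →
    pivotRow (lincomb w e) ≡ ⨁ (λ k → e k ∧ pivotRow (w k))
  pivotRow-lincomb w e = begin
    ⨁ (λ l → Mₐ l ∧ ⨁ (λ k → e k ∧ w k l))          ≡⟨ ⨁-cong (λ l → sym (⨁-∧ˡ (Mₐ l) (λ k → e k ∧ w k l))) ⟩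
    ⨁ (λ l → ⨁ (λ k → Mₐ l ∧ (e k ∧ w k l)))        ≡⟨ ⨁-swap (λ l k → Mₐ l ∧ (e k ∧ w k l)) ⟩
    ⨁ (λ k → ⨁ (λ l → Mₐ l ∧ (e k ∧ w k l)))        ≡⟨ ⨁-cong (λ k → ⨁-cong (λ l → rotate (Mₐ l) (e k) (w k l))) ⟩
    ⨁ (λ k → ⨁ (λ l → e k ∧ (Mₐ l ∧ w k l)))        ≡⟨ ⨁-cong (λ k → ⨁-∧ˡ (e k) (λ l → Mₐ l ∧ w k l)) ⟩
    ⨁ (λ k → e k ∧ pivotRow (w k))                  ∎
    where
    Mₐ = M a ∘ punchIn b
    rotate : ∀ x y z → x ∧ (y ∧ z) ≡ y ∧ (x ∧ z)
    rotate = solve 3 (λ x y z → x :* (y :* z) := y :* (x :* z)) refl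

  mulV-pivotRow : ∀ x → mulV M x a ≡ x b xor pivotRow (x ∘ punchIn b)
  mulV-pivotRow x =
    trans (⨁-punchIn (λ j → M a j ∧ x j) b) (cong (λ t → (t ∧ x b) xor pivotRow (x ∘ punchIn b)) pivot)

  mulV-otherRow : ∀ x k →
    mulV M x (punchIn a k) ≡ (mulV M x a ∧ M (punchIn a k) b) xor mulV schur (x ∘ punchIn b) k
  mulV-otherRow x k = begin
    mulV M x (punchIn a k)                          ≡⟨ ⨁-punchIn (λ j → M (punchIn a k) j ∧ x j) b ⟩
    (β ∧ x b) xor S                                 ≡⟨ regroup β (x b) (pivotRow z) S ⟩
    ((x b xor pivotRow z) ∧ β) xor (S xor (β ∧ pivotRow z))
      ≡⟨ cong₂ _xor_ (cong (_∧ β) (sym (mulV-pivotRow x)))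
                     (sym (⨁-xor-∧ β (M (punchIn a k) ∘ punchIn b) (M a ∘ punchIn b) z)) ⟩
    (mulV M x a ∧ β) xor mulV schur z k             ∎
    where
    z = x ∘ punchIn b
    β = M (punchIn a k) b
    S = ⨁ (λ l → M (punchIn a k) (punchIn b l) ∧ z l)
    regroup : ∀ β x R S → (β ∧ x) xor S ≡ ((x xor R) ∧ β) xor (S xor (β ∧ R))
    regroup = solve 4 (λ β x R S → (β :* x) :+ S := ((x :+ R) :* β) :+ (S :+ (β :* R))) refl

  lift : Vec₂ c → Vec₂ (suc c)
  lift z = insertAt z b (pivotRow z)

  mulV-lift-pivotRow : ∀ z → mulV M (lift z) a ≡ false
  mulV-lift-pivotRow z = begin
    mulV M (lift z) a                            ≡⟨ mulV-pivotRow (lift z) ⟩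
    lift z b xor pivotRow (lift z ∘ punchIn b)
      ≡⟨ cong₂ _xor_ (insertAt-lookup z b (pivotRow z)) (pivotRow-cong (insertAt-punchIn z b (pivotRow z))) ⟩
    pivotRow z xor pivotRow z                    ≡⟨ xor-same (pivotRow z) ⟩
    false                                        ∎

  mulV-lift-otherRow : ∀ z k → mulV M (lift z) (punchIn a k) ≡ mulV schur z k
  mulV-lift-otherRow z k =
    trans (mulV-otherRow (lift z) k)
          (cong₂ (λ u v → (u ∧ M (punchIn a k) b) xor v) (mulV-lift-pivotRow z)
                 (mulV-congʳ schur (insertAt-punchIn z b (pivotRow z)) k))

  columnFamily : ∀ {ρ} → (Fin ρ → Vec₂ r) → Fin (suc ρ) → Vec₂ (suc r)
  columnFamily v = (λ i → M i b) ∷ (λ k → insertAt (v k) a false)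

  lincomb-columnFamily-pivotRow : ∀ {ρ} (v : Fin ρ → Vec₂ r) e → lincomb (columnFamily v) e a ≡ e fz
  lincomb-columnFamily-pivotRow v e = begin
    (e fz ∧ M a b) xor ⨁ (λ k → e (fs k) ∧ insertAt (v k) a false a)
      ≡⟨ cong₂ (λ p q → (e fz ∧ p) xor q) pivot
               (⨁-zero (λ k → trans (cong (e (fs k) ∧_) (insertAt-lookup (v k) a false)) (∧-zeroʳ (e (fs k))))) ⟩
    (e fz ∧ true) xor false                       ≡⟨ trans (xor-identityʳ (e fz ∧ true)) (∧-identityʳ (e fz)) ⟩
    e fz                                          ∎

  lincomb-columnFamily-otherRow : ∀ {ρ} (v : Fin ρ → Vec₂ r) e k →
    lincomb (columnFamily v) e (punchIn a k) ≡ (e fz ∧ M (punchIn a k) b) xor lincomb v (e ∘ fs) k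
  lincomb-columnFamily-otherRow v e k =
    cong ((e fz ∧ M (punchIn a k) b) xor_) (⨁-cong (λ k′ → cong (e (fs k′) ∧_) (insertAt-punchIn (v k′) a false k)))

  extendColumnBasis : ∀ {ρ} → Basis (ColSpace schur) ρ → Basis (ColSpace M) (suc ρ)
  extendColumnBasis B = record { vec = C ; vec∈ = C∈ ; independent = C-indep ; spanning = C-spans }
    where
    open Basis B
    C = columnFamily vec

    C∈ : ∀ k → ColSpace M (C k)
    C∈ fz     = (λ j → δ j b) , λ i → ⨁-δ (M i) b
    C∈ (fs k) with vec∈ k
    ... | z , schur-z≗v =
      lift z , ≗-byPunchIn a (trans (mulV-lift-pivotRow z) (sym (insertAt-lookup (vec k) a false)))
                             λ k′ → trans (mulV-lift-otherRow z k′)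
                                          (trans (schur-z≗v k′) (sym (insertAt-punchIn (vec k) a false k′)))

    C-indep : LinIndep C
    C-indep e e-dep = λ { fz → e₀≡0 ; (fs k) → independent (e ∘ fs) tail-dep k }
      where
      e₀≡0 : e fz ≡ false
      e₀≡0 = trans (sym (lincomb-columnFamily-pivotRow vec e)) (e-dep a)
      tail-dep : ∀ k → lincomb vec (e ∘ fs) k ≡ false
      tail-dep k = begin
        lincomb vec (e ∘ fs) k
          ≡⟨ cong (λ t → (t ∧ M (punchIn a k) b) xor lincomb vec (e ∘ fs) k) (sym e₀≡0) ⟩
        (e fz ∧ M (punchIn a k) b) xor lincomb vec (e ∘ fs) k   ≡⟨ sym (lincomb-columnFamily-otherRow vec e k) ⟩
        lincomb C e (punchIn a k)                              ≡⟨ e-dep (punchIn a k) ⟩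
        false                                                  ∎

    C-spans : ∀ y → ColSpace M y → Spans C y
    C-spans y (x , Mx≗y) with spanning (mulV schur (x ∘ punchIn b)) (x ∘ punchIn b , λ _ → refl)
    ... | coeffs , coeffs-spans = e , ≗-byPunchIn a (trans (lincomb-columnFamily-pivotRow vec e) (Mx≗y a)) elsewhere
      where
      e = mulV M x a ∷ coeffs
      elsewhere : ∀ k → lincomb C e (punchIn a k) ≡ y (punchIn a k)
      elsewhere k = begin
        lincomb C e (punchIn a k)                                     ≡⟨ lincomb-columnFamily-otherRow vec e k ⟩
        (mulV M x a ∧ M (punchIn a k) b) xor lincomb vec coeffs k
          ≡⟨ cong ((mulV M x a ∧ M (punchIn a k) b) xor_) (coeffs-spans k) ⟩
        (mulV M x a ∧ M (punchIn a k) b) xor mulV schur (x ∘ punchIn b) k  ≡⟨ sym (mulV-otherRow x k) ⟩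
        mulV M x (punchIn a k)                                        ≡⟨ Mx≗y (punchIn a k) ⟩
        y (punchIn a k)                                               ∎

  liftKernelBasis : ∀ {κ} → Basis (Kernel schur) κ → Basis (Kernel M) κ
  liftKernelBasis B = record { vec = lift ∘ vec ; vec∈ = K∈ ; independent = K-indep ; spanning = K-spans }
    where
    open Basis B

    K∈ : ∀ k → Kernel M (lift (vec k))
    K∈ k = ≗-byPunchIn a (mulV-lift-pivotRow (vec k)) λ k′ → trans (mulV-lift-otherRow (vec k) k′) (vec∈ k k′)

    lincomb-lift : ∀ e l → lincomb (lift ∘ vec) e (punchIn b l) ≡ lincomb vec e l
    lincomb-lift e l = ⨁-cong (λ k → cong (e k ∧_) (insertAt-punchIn (vec k) b (pivotRow (vec k)) l))

    K-indep : LinIndep (lift ∘ vec)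
    K-indep e e-dep = independent e (λ l → trans (sym (lincomb-lift e l)) (e-dep (punchIn b l)))

    K-spans : ∀ x → Kernel M x → Spans (lift ∘ vec) x
    K-spans x Mx≡0 = coeffs , ≗-byPunchIn b at-b (λ l → trans (lincomb-lift coeffs l) (coeffs-spans l))
      where
      z = x ∘ punchIn b
      z∈ker : Kernel schur z
      z∈ker k = begin
        mulV schur z k                                          ≡⟨⟩
        (false ∧ M (punchIn a k) b) xor mulV schur z k
          ≡⟨ cong (λ t → (t ∧ M (punchIn a k) b) xor mulV schur z k) (sym (Mx≡0 a)) ⟩
        (mulV M x a ∧ M (punchIn a k) b) xor mulV schur z k     ≡⟨ sym (mulV-otherRow x k) ⟩
        mulV M x (punchIn a k)                                  ≡⟨ Mx≡0 (punchIn a k) ⟩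
        false                                                   ∎
      coeffs = proj₁ (spanning z z∈ker)
      coeffs-spans = proj₂ (spanning z z∈ker)
      xb≡pivotRow : x b ≡ pivotRow z
      xb≡pivotRow = trans (sym (xor-identityʳ (x b))) (sym (xor-moveˡ (x b) (trans (sym (mulV-pivotRow x)) (Mx≡0 a))))
      at-b : lincomb (lift ∘ vec) coeffs b ≡ x b
      at-b = begin
        ⨁ (λ k → coeffs k ∧ lift (vec k) b)
          ≡⟨ ⨁-cong (λ k → cong (coeffs k ∧_) (insertAt-lookup (vec k) b (pivotRow (vec k)))) ⟩
        ⨁ (λ k → coeffs k ∧ pivotRow (vec k))   ≡⟨ sym (pivotRow-lincomb vec coeffs) ⟩
        pivotRow (lincomb vec coeffs)           ≡⟨ pivotRow-cong coeffs-spans ⟩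
        pivotRow z                              ≡⟨ sym xb≡pivotRow ⟩
        x b                                     ∎

  rankNullity : RankNullity schur → RankNullity M
  rankNullity R = record
    { rank         = suc rank
    ; nullity      = nullity
    ; rank+nullity = cong suc rank+nullity
    ; columnBasis  = extendColumnBasis columnBasis
    ; kernelBasis  = liftKernelBasis kernelBasis
    }
    where open RankNullity R

-- Symmetric matrices

IsSymmetric : ∀ {n} → Mat₂ n n → Set
IsSymmetric M = ∀ i j → M i j ≡ M j i

RankNullityOfParity : ∀ {m n} → Mat₂ m n → Bool → Set
RankNullityOfParity M t = Σ (RankNullity M) λ R → odd (RankNullity.rank R) ≡ t

punchIn-punchOut-swap : ∀ {n} {i j : Fin (suc (suc n))} (i≢j : i ≢ j) (j≢i : j ≢ i) k →
  punchIn i (punchIn (punchOut i≢j) k) ≡ punchIn j (punchIn (punchOut j≢i) k)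
punchIn-punchOut-swap {i = fz}   {fz}   i≢j _ k = ⊥-elim (i≢j refl)
punchIn-punchOut-swap {i = fz}   {fs j} _   _ k = refl
punchIn-punchOut-swap {i = fs i} {fz}   _   _ k = refl
punchIn-punchOut-swap {suc n} {fs i} {fs j} _ _ fz = refl
punchIn-punchOut-swap {suc n} {fs i} {fs j} i≢j j≢i (fs k) =
  cong fs (punchIn-punchOut-swap (i≢j ∘ cong fs) (j≢i ∘ cong fs) k)

module DiagonalPivot {m} (M : Mat₂ (suc m) (suc m)) (M-sym : IsSymmetric M)
                     (s : Vec₂ (suc m)) (Ms≡diag : ∀ i → mulV M s i ≡ M i i)
                     (i : Fin (suc m)) (Mii : M i i ≡ true) where

  open Pivot M i i Mii public

  s′ : Vec₂ m
  s′ = s ∘ punchIn i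

  schur-sym : IsSymmetric schur
  schur-sym k l = cong₂ _xor_ (M-sym (punchIn i k) (punchIn i l))
    (trans (∧-comm (M (punchIn i k) i) (M i (punchIn i l)))
           (cong₂ _∧_ (M-sym i (punchIn i l)) (M-sym (punchIn i k) i)))

  schur-diag : ∀ k → schur k k ≡ M (punchIn i k) (punchIn i k) xor M (punchIn i k) i
  schur-diag k = cong (M (punchIn i k) (punchIn i k) xor_)
    (trans (cong (M (punchIn i k) i ∧_) (M-sym i (punchIn i k))) (∧-idem (M (punchIn i k) i)))

  schur-s′≡diag : ∀ k → mulV schur s′ k ≡ schur k k
  schur-s′≡diag k = begin
    mulV schur s′ k                  ≡⟨ xor-moveˡ β (sym Mkk≡) ⟩
    β xor M (punchIn i k) (punchIn i k) ≡⟨ xor-comm β _ ⟩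
    M (punchIn i k) (punchIn i k) xor β ≡⟨ sym (schur-diag k) ⟩
    schur k k                        ∎
    where
    β = M (punchIn i k) i
    Mkk≡ : M (punchIn i k) (punchIn i k) ≡ β xor mulV schur s′ k
    Mkk≡ = begin
      M (punchIn i k) (punchIn i k)                   ≡⟨ sym (Ms≡diag (punchIn i k)) ⟩
      mulV M s (punchIn i k)                          ≡⟨ mulV-otherRow s k ⟩
      (mulV M s i ∧ β) xor mulV schur s′ k            ≡⟨ cong (λ t → (t ∧ β) xor mulV schur s′ k) (trans (Ms≡diag i) Mii) ⟩
      β xor mulV schur s′ k                           ∎

  -- Row i of M s = diag M says pivotRow s′ = sᵢ + 1, so the pivot adds exactly 1 to s · diag M.
  parity-step : ⨁ (λ j → s j ∧ M j j) ≡ not (⨁ (λ k → s′ k ∧ schur k k))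
  parity-step = begin
    ⨁ (λ j → s j ∧ M j j)                ≡⟨ ⨁-punchIn (λ j → s j ∧ M j j) i ⟩
    (s i ∧ M i i) xor Σ′                  ≡⟨ cong (λ t → (s i ∧ t) xor Σ′) Mii ⟩
    (s i ∧ true) xor Σ′                   ≡⟨ cong (_xor Σ′) (∧-identityʳ (s i)) ⟩
    s i xor Σ′                            ≡⟨ flip (s i) Σ′ ⟩
    not (Σ′ xor (s i xor true))           ≡⟨ cong (λ t → not (Σ′ xor t)) (sym R≡) ⟩
    not (Σ′ xor pivotRow s′)              ≡⟨ cong not (sym schur-sum) ⟩
    not (⨁ (λ k → s′ k ∧ schur k k))      ∎
    where
    Σ′ = ⨁ (λ k → s′ k ∧ M (punchIn i k) (punchIn i k))
    R≡ : pivotRow s′ ≡ s i xor true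
    R≡ = xor-moveˡ (s i) (trans (sym (mulV-pivotRow s)) (trans (Ms≡diag i) Mii))
    schur-sum : ⨁ (λ k → s′ k ∧ schur k k) ≡ Σ′ xor pivotRow s′
    schur-sum = trans (⨁-cong term) (⨁-xor (λ k → s′ k ∧ M (punchIn i k) (punchIn i k))
                                            (λ k → M i (punchIn i k) ∧ s′ k))
      where
      term : ∀ k → s′ k ∧ schur k k ≡ (s′ k ∧ M (punchIn i k) (punchIn i k)) xor (M i (punchIn i k) ∧ s′ k)
      term k = begin
        s′ k ∧ schur k k ≡⟨ cong (s′ k ∧_) (schur-diag k) ⟩
        s′ k ∧ (M (punchIn i k) (punchIn i k) xor M (punchIn i k) i)
          ≡⟨ ∧-distribˡ-xor (s′ k) _ _ ⟩
        (s′ k ∧ M (punchIn i k) (punchIn i k)) xor (s′ k ∧ M (punchIn i k) i)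
          ≡⟨ cong ((s′ k ∧ M (punchIn i k) (punchIn i k)) xor_)
                  (trans (∧-comm (s′ k) _) (cong (_∧ s′ k) (M-sym (punchIn i k) i))) ⟩
        (s′ k ∧ M (punchIn i k) (punchIn i k)) xor (M i (punchIn i k) ∧ s′ k) ∎
    flip : ∀ x y → x xor y ≡ not (y xor (x xor true))
    flip = solve 2 (λ x y → x :+ y := con true :+ (y :+ (x :+ con true))) refl

  rankNullityOfParity : RankNullityOfParity schur (⨁ (λ k → s′ k ∧ schur k k)) →
                        RankNullityOfParity M (⨁ (λ j → s j ∧ M j j))
  rankNullityOfParity (R , odd-rank) = rankNullity R , trans (cong not odd-rank) (sym parity-step)

-- Pivots on M i j and then on the old entry M j i, which sits at (j′ , i′) in M₁.
module PairPivot {m} (M : Mat₂ (suc (suc m)) (suc (suc m))) (M-sym : IsSymmetric M)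
                 (M-diag : ∀ i → M i i ≡ false) (i j : Fin (suc (suc m))) (Mij : M i j ≡ true) where

  i≢j : i ≢ j
  i≢j refl with trans (sym (M-diag i)) Mij
  ... | ()

  j′ i′ : Fin (suc m)
  j′ = punchOut i≢j
  i′ = punchOut (i≢j ∘ sym)

  module P₁ = Pivot M i j Mij

  M₁ : Mat₂ (suc m) (suc m)
  M₁ = P₁.schur

  M₁-row-j′ : ∀ l → M₁ j′ l ≡ M j (punchIn j l)
  M₁-row-j′ l = begin
    M (punchIn i j′) (punchIn j l) xor (M (punchIn i j′) j ∧ M i (punchIn j l))
      ≡⟨ cong (λ r → M r (punchIn j l) xor (M r j ∧ M i (punchIn j l))) (punchIn-punchOut i≢j) ⟩
    M j (punchIn j l) xor (M j j ∧ M i (punchIn j l))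
      ≡⟨ cong (λ t → M j (punchIn j l) xor (t ∧ M i (punchIn j l))) (M-diag j) ⟩
    M j (punchIn j l) xor false      ≡⟨ xor-identityʳ _ ⟩
    M j (punchIn j l)                ∎

  M₁-col-i′ : ∀ k → M₁ k i′ ≡ M (punchIn i k) i
  M₁-col-i′ k = begin
    M (punchIn i k) (punchIn j i′) xor (M (punchIn i k) j ∧ M i (punchIn j i′))
      ≡⟨ cong (λ c → M (punchIn i k) c xor (M (punchIn i k) j ∧ M i c)) (punchIn-punchOut (i≢j ∘ sym)) ⟩
    M (punchIn i k) i xor (M (punchIn i k) j ∧ M i i)
      ≡⟨ cong (λ t → M (punchIn i k) i xor (M (punchIn i k) j ∧ t)) (M-diag i) ⟩
    M (punchIn i k) i xor (M (punchIn i k) j ∧ false)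
      ≡⟨ cong (M (punchIn i k) i xor_) (∧-zeroʳ _) ⟩
    M (punchIn i k) i xor false      ≡⟨ xor-identityʳ _ ⟩
    M (punchIn i k) i                ∎

  pivot₂ : M₁ j′ i′ ≡ true
  pivot₂ = trans (M₁-row-j′ i′) (trans (cong (M j) (punchIn-punchOut (i≢j ∘ sym))) (trans (M-sym j i) Mij))

  module P₂ = Pivot M₁ j′ i′ pivot₂

  M₂ : Mat₂ m m
  M₂ = P₂.schur

  E : Fin m → Fin (suc (suc m))
  E k = punchIn i (punchIn j′ k)

  X : Fin m → Fin m → Bool
  X k l = M (E k) j ∧ M i (E l)

  M₂-entry : ∀ k l → M₂ k l ≡ (M (E k) (E l) xor X k l) xor X l k
  M₂-entry k l = begin
    M₁ (punchIn j′ k) (punchIn i′ l) xor (M₁ (punchIn j′ k) i′ ∧ M₁ j′ (punchIn i′ l))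
      ≡⟨ cong₂ (λ x y → M₁ (punchIn j′ k) (punchIn i′ l) xor (x ∧ y))
               (M₁-col-i′ (punchIn j′ k)) (M₁-row-j′ (punchIn i′ l)) ⟩
    (M (E k) (E′ l) xor (M (E k) j ∧ M i (E′ l))) xor (M (E k) i ∧ M j (E′ l))
      ≡⟨ cong (λ c → (M (E k) c xor (M (E k) j ∧ M i c)) xor (M (E k) i ∧ M j c))
              (sym (punchIn-punchOut-swap i≢j (i≢j ∘ sym) l)) ⟩
    (M (E k) (E l) xor X k l) xor (M (E k) i ∧ M j (E l))
      ≡⟨ cong ((M (E k) (E l) xor X k l) xor_)
              (trans (∧-comm (M (E k) i) (M j (E l))) (cong₂ _∧_ (M-sym j (E l)) (M-sym (E k) i))) ⟩
    (M (E k) (E l) xor X k l) xor X l k ∎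
    where
    E′ = λ l → punchIn j (punchIn i′ l)

  M₂-sym : IsSymmetric M₂
  M₂-sym k l = begin
    M₂ k l                                 ≡⟨ M₂-entry k l ⟩
    (M (E k) (E l) xor X k l) xor X l k    ≡⟨ swap (M (E k) (E l)) (X k l) (X l k) ⟩
    (M (E k) (E l) xor X l k) xor X k l    ≡⟨ cong (λ t → (t xor X l k) xor X k l) (M-sym (E k) (E l)) ⟩
    (M (E l) (E k) xor X l k) xor X k l    ≡⟨ sym (M₂-entry l k) ⟩
    M₂ l k                                 ∎
    where
    swap : ∀ a x y → (a xor x) xor y ≡ (a xor y) xor x
    swap = solve 3 (λ a x y → (a :+ x) :+ y := (a :+ y) :+ x) refl

  M₂-diag : ∀ k → M₂ k k ≡ false
  M₂-diag k = begin
    M₂ k k                                 ≡⟨ M₂-entry k k ⟩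
    (M (E k) (E k) xor X k k) xor X k k    ≡⟨ cong (λ t → (t xor X k k) xor X k k) (M-diag (E k)) ⟩
    X k k xor X k k                        ≡⟨ xor-same (X k k) ⟩
    false                                  ∎

  rankNullityOfParity : RankNullityOfParity M₂ false → RankNullityOfParity M false
  rankNullityOfParity (R , odd-rank) =
    P₁.rankNullity (P₂.rankNullity R) , trans (not-involutive (odd (RankNullity.rank R))) odd-rank

alternating-rankNullity : ∀ n (M : Mat₂ n n) → IsSymmetric M → (∀ i → M i i ≡ false) →
  RankNullityOfParity M false
alternating-rankNullity zero          M _     _      = zero-rankNullity M (λ ()) , refl
alternating-rankNullity (suc zero)    M _     M-diag = zero-rankNullity M (λ { fz fz → M-diag fz }) , refl
alternating-rankNullity (suc (suc m)) M M-sym M-diag with nonzeroEntry? M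
... | inj₂ M≡0 = zero-rankNullity M M≡0 , refl
... | inj₁ (i , j , Mij) = rankNullityOfParity (alternating-rankNullity m M₂ M₂-sym M₂-diag)
  where open PairPivot M M-sym M-diag i j Mij

symmetric-rankNullity : ∀ n (M : Mat₂ n n) → IsSymmetric M → ∀ s → (∀ i → mulV M s i ≡ M i i) →
  RankNullityOfParity M (⨁ (λ i → s i ∧ M i i))
symmetric-rankNullity zero    M _     _ _       = zero-rankNullity M (λ ()) , refl
symmetric-rankNullity (suc m) M M-sym s Ms≡diag with trueEntry? (λ i → M i i)
... | inj₁ (i , Mii) = rankNullityOfParity (symmetric-rankNullity m schur schur-sym s′ schur-s′≡diag)
  where open DiagonalPivot M M-sym s Ms≡diag i Mii
... | inj₂ M-diag with alternating-rankNullity (suc m) M M-sym M-diag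
...   | R , odd-rank = R , trans odd-rank (sym (⨁-zero (λ i → trans (cong (s i ∧_) (M-diag i)) (∧-zeroʳ (s i)))))

-- Closed neighbourhood matrices

inN-sym : ∀ {n} (G : Graph n) u v → inN G u v ≡ inN G v u
inN-sym G u v with v ≟ u | u ≟ v
... | yes _   | yes _   = refl
... | no _    | no _    = Graph.sym G u v
... | yes v≡u | no u≢v  = ⊥-elim (u≢v (sym v≡u))
... | no v≢u  | yes u≡v = ⊥-elim (v≢u (sym u≡v))

inN-refl : ∀ {n} (G : Graph n) u → inN G u u ≡ true
inN-refl G u with u ≟ u
... | yes _   = refl
... | no u≢u = ⊥-elim (u≢u refl)

NMat-sym : ∀ {n} (G : Graph n) → IsSymmetric (NMat G)
NMat-sym G i j = inN-sym G j i

OddDominating⇒NS≡diag : ∀ {n} (G : Graph n) S → OddDominating G S → ∀ i → mulV (NMat G) S i ≡ NMat G i i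
OddDominating⇒NS≡diag G S odd-dom i = begin
  ⨁ (λ j → inN G j i ∧ S j)               ≡⟨ ⨁-cong (λ j → cong (_∧ S j) (inN-sym G j i)) ⟩
  ⨁ (λ j → inN G i j ∧ S j)               ≡⟨ ⨁≡odd-card (λ j → inN G i j ∧ S j) ⟩
  odd (card (λ j → inN G i j ∧ S j))      ≡⟨ %2≡1⇒odd (card (λ j → inN G i j ∧ S j)) (odd-dom i) ⟩
  true                                    ≡⟨ sym (inN-refl G i) ⟩
  inN G i i                               ∎

S·diagN≡odd-card : ∀ {n} (G : Graph n) S → ⨁ (λ i → S i ∧ NMat G i i) ≡ odd (card S)
S·diagN≡odd-card G S =
  trans (⨁-cong (λ i → trans (cong (S i ∧_) (inN-refl G i)) (∧-identityʳ (S i)))) (⨁≡odd-card S)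

theorem2p4 : ∀ (n : ℕ) (G : Graph n) (S : Vec₂ n) → OddDominating G S →
    (∀ r → IsRank G r → card S % 2 ≡ r % 2)
    × (∀ k → IsNullity G k → card (compl S) % 2 ≡ k % 2)
theorem2p4 n G S odd-dom = rank-parity , nullity-parity
  where
  RN = symmetric-rankNullity n (NMat G) (NMat-sym G) S (OddDominating⇒NS≡diag G S odd-dom)
  open RankNullity (proj₁ RN)

  odd-rank : odd rank ≡ odd (card S)
  odd-rank = trans (proj₂ RN) (S·diagN≡odd-card G S)

  rank-parity : ∀ r → IsRank G r → card S % 2 ≡ r % 2
  rank-parity r r-isRank =
    odd≡⇒%2≡ (card S) r (trans (sym odd-rank) (cong odd (sym (dim-unique columnBasis r-isRank))))

  nullity-parity : ∀ k → IsNullity G k → card (compl S) % 2 ≡ k % 2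
  nullity-parity k k-isNullity = odd≡⇒%2≡ (card (compl S)) k
    (trans (sym (odd-compl S rank nullity rank+nullity odd-rank))
           (cong odd (sym (dim-unique kernelBasis k-isNullity))))
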